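{- Let $\Gamma,\Delta$ be finite sets of formulas in $For_2$ with $\Gamma\cup\Delta$ nonempty. If $\vDash_{\mathbf{B}_3}\Gamma\Rightarrow\Delta$ but $var(\Delta)\not\subseteq var(\Gamma)$, then there exists a proper subset $\Delta'\subset\Delta$ with $var(\Delta')\subseteq var(\Gamma)$ such that $\vDash_{\mathbf{B}_3}\Gamma\Rightarrow\Delta'$.
   Context: Fix a denumerable set $prop$ of propositional variables. $For_2$ is the set of formulas built from $prop$ with unary $\lnot$ and binary $\wedge$. $var(\alpha)$ is the set of propositional variables in $\alpha$; $var(\Gamma)=\bigcup_{\gamma\in\Gamma}var(\gamma)$. Bochvar's logic $\mathbf{B}_3$: truth values $\{1,\tfrac12,0\}$, designated set $\{1\}$; valuations extend maps $prop\to\{1,\tfrac12,0\}$ by $\lnot1=0,\lnot\tfrac12=\tfrac12,\lnot0=1$, and $x\wedge y=\tfrac12$ if $x=\tfrac12$ or $y=\tfrac12$, otherwise classical conjunction. $\vDash_{\mathbf{B}_3}\Gamma\Rightarrow\Delta$ means: for every valuation $v$, if $v(\gamma)=1$ for all $\gamma\in\Gamma$ then $v(\delta)=1$ for some $\delta\in\Delta$. -}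

module Defs where

open import Data.Nat using (ℕ)
open import Data.List using (List; []; _∷_; _++_; concatMap)
open import Data.List.Membership.Propositional using (_∈_)
open import Data.List.Relation.Unary.All using (All)
open import Data.List.Relation.Unary.Any using (Any)
open import Relation.Binary.PropositionalEquality using (_≡_)
open import Relation.Nullary using (¬_)
open import Data.Product using (_×_; Σ; ∃)

Prop : Set
Prop = ℕ

data Formula : Set where
  var : Prop → Formula
  ¬'_ : Formula → Formula
  _∧'_ : Formula → Formula → Formula

vars : Formula → List Prop
vars (var p) = p ∷ []
vars (¬' a) = vars a
vars (a ∧' b) = vars a ++ vars b

varsL : List Formula → List Prop
varsL Γ = concatMap vars Γ

data V3 : Set where
  one half zero : V3

neg3 : V3 → V3
neg3 one = zero
neg3 half = half
neg3 zero = one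

and3 : V3 → V3 → V3
and3 half _ = half
and3 one half = half
and3 zero half = half
and3 one one = one
and3 one zero = zero
and3 zero one = zero
and3 zero zero = zero

eval : (Prop → V3) → Formula → V3
eval v (var p) = v p
eval v (¬' a) = neg3 (eval v a)
eval v (a ∧' b) = and3 (eval v a) (eval v b)

Valid : List Formula → List Formula → Set
Valid Γ Δ = (v : Prop → V3) →
  All (λ γ → eval v γ ≡ one) Γ → Any (λ δ → eval v δ ≡ one) Δ

-- inclusion of finite sets represented as lists (membership based)
_⊆ˢ_ : {A : Set} → List A → List A → Set
xs ⊆ˢ ys = ∀ {x} → x ∈ xs → x ∈ ys

_⊂ˢ_ : {A : Set} → List A → List A → Set
xs ⊂ˢ ys = xs ⊆ˢ ys × Σ _ (λ y → y ∈ ys × ¬ (y ∈ xs))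

-- The value ½ is infectious in B₃: a formula containing a variable valued ½
-- is itself valued ½, so a formula that takes the designated value 1 has no
-- variable valued ½.  Given a valid sequent Γ ⇒ Δ, let Δ' be the sublist of
-- those δ ∈ Δ whose variables all lie in var(Γ).  To see that Γ ⇒ Δ' is
-- valid, take a valuation v satisfying Γ and modify it to ½ outside var(Γ).
-- The modified valuation still satisfies Γ (evaluation depends only on the
-- variables of a formula), hence makes some δ ∈ Δ true; by infectiousness δ
-- has no variable outside var(Γ), so δ ∈ Δ', and v agrees with the
-- modification on var(δ).  Finally Δ' is a proper sublist because some
-- variable of Δ is not in var(Γ).
module Submission where

open import Defs
open import Data.List using (List; []; filter; _++_)
open import Data.List.Relation.Unary.All as All using (All; all?)
open import Data.List.Relation.Unary.Any using (Any; any?; here)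
open import Data.List.Membership.Propositional using (_∈_; find; lose)
open import Data.List.Membership.Propositional.Properties
  using (∈-++⁺ˡ; ∈-++⁺ʳ; ∈-++⁻; ∈-concatMap⁺; ∈-concatMap⁻; ∈-filter⁺; ∈-filter⁻)
open import Data.Nat using (_≟_)
open import Data.List.Membership.DecPropositional _≟_ using (_∈?_)
open import Data.Empty using (⊥-elim)
open import Data.Product using (Σ; _×_; _,_; proj₁; proj₂)
open import Data.Sum using (inj₁; inj₂)
open import Relation.Nullary using (¬_; ¬?; yes; no)
open import Relation.Unary using (Decidable)
open import Relation.Binary.PropositionalEquality
  using (_≡_; _≢_; refl; sym; trans; cong; cong₂)

eval-local : ∀ v w a → (∀ {x} → x ∈ vars a → v x ≡ w x) → eval v a ≡ eval w a
eval-local v w (var p) agree = agree (here refl)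
eval-local v w (¬' a) agree = cong neg3 (eval-local v w a agree)
eval-local v w (a ∧' b) agree =
  cong₂ and3 (eval-local v w a (λ m → agree (∈-++⁺ˡ m)))
             (eval-local v w b (λ m → agree (∈-++⁺ʳ (vars a) m)))

half-infectious : ∀ v a {x} → x ∈ vars a → v x ≡ half → eval v a ≡ half
half-infectious v (var p) (here refl) vx = vx
half-infectious v (¬' a) m vx rewrite half-infectious v a m vx = refl
half-infectious v (a ∧' b) m vx with ∈-++⁻ (vars a) m
... | inj₁ ma rewrite half-infectious v a ma vx = refl
... | inj₂ mb rewrite half-infectious v b mb vx with eval v a
...   | one = refl
...   | half = refl
...   | zero = refl

true⇒no-half : ∀ v a {x} → eval v a ≡ one → x ∈ vars a → v x ≢ half
true⇒no-half v a va m vx with () ← trans (sym va) (half-infectious v a m vx)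

restrict : List Prop → (Prop → V3) → Prop → V3
restrict S v p with p ∈? S
... | yes _ = v p
... | no _ = half

restrict-inside : ∀ S v {p} → p ∈ S → restrict S v p ≡ v p
restrict-inside S v {p} p∈S with p ∈? S
... | yes _ = refl
... | no p∉S = ⊥-elim (p∉S p∈S)

restrict-outside : ∀ S v {p} → ¬ p ∈ S → restrict S v p ≡ half
restrict-outside S v {p} p∉S with p ∈? S
... | yes p∈S = ⊥-elim (p∉S p∈S)
... | no _ = refl

Over : List Prop → Formula → Set
Over S δ = All (_∈ S) (vars δ)

over? : (S : List Prop) → Decidable (Over S)
over? S δ = all? (_∈? S) (vars δ)

eval-restrict : ∀ S v a → Over S a → eval (restrict S v) a ≡ eval v a
eval-restrict S v a over =
  eval-local (restrict S v) v a (λ m → restrict-inside S v (All.lookup over m))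

true-under-restrict⇒over : ∀ S v a → eval (restrict S v) a ≡ one → Over S a
true-under-restrict⇒over S v a true = All.tabulate over
  where
  over : ∀ {x} → x ∈ vars a → x ∈ S
  over {x} m with x ∈? S
  ... | yes x∈S = x∈S
  ... | no x∉S = ⊥-elim (true⇒no-half (restrict S v) a true m (restrict-outside S v x∉S))

overPart : List Prop → List Formula → List Formula
overPart S = filter (over? S)

overPart-⊆ : ∀ S Δ → overPart S Δ ⊆ˢ Δ
overPart-⊆ S Δ m = proj₁ (∈-filter⁻ (over? S) {xs = Δ} m)

overPart-vars : ∀ S Δ → varsL (overPart S Δ) ⊆ˢ S
overPart-vars S Δ m with find (∈-concatMap⁻ vars {xs = overPart S Δ} m)
... | δ , mδ , mx = All.lookup (proj₂ (∈-filter⁻ (over? S) {xs = Δ} mδ)) mx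

overPart-drops : ∀ S Δ → ¬ (varsL Δ ⊆ˢ S) →
  Σ Formula (λ δ → δ ∈ Δ × ¬ δ ∈ overPart S Δ)
overPart-drops S Δ ¬vars⊆S with any? (λ δ → ¬? (over? S δ)) Δ
... | yes someNotOver with find someNotOver
...   | δ , mδ , ¬over = δ , mδ , λ m → ¬over (proj₂ (∈-filter⁻ (over? S) {xs = Δ} m))
overPart-drops S Δ ¬vars⊆S | no noneNotOver = ⊥-elim (¬vars⊆S vars⊆S)
  where
  vars⊆S : varsL Δ ⊆ˢ S
  vars⊆S m with find (∈-concatMap⁻ vars {xs = Δ} m)
  ... | δ , mδ , mx with over? S δ
  ...   | yes over = All.lookup over mx
  ...   | no ¬over = ⊥-elim (noneNotOver (lose mδ ¬over))

valid-overPart : ∀ S Γ Δ → varsL Γ ⊆ˢ S → Valid Γ Δ → Valid Γ (overPart S Δ)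
valid-overPart S Γ Δ varsΓ⊆S valid v satΓ = pick (find (valid (restrict S v) satΓ-restricted))
  where
  -- Every γ ∈ Γ lies over S, so the restricted valuation still satisfies Γ.
  satΓ-restricted : All (λ γ → eval (restrict S v) γ ≡ one) Γ
  satΓ-restricted = All.tabulate λ {γ} mγ →
    let over = All.tabulate λ mx → varsΓ⊆S (∈-concatMap⁺ vars (lose mγ mx))
    in trans (eval-restrict S v γ over) (All.lookup satΓ mγ)

  -- The δ ∈ Δ made true by the restriction lies over S, so it survives the
  -- filter and is true under v itself.
  pick : Σ Formula (λ δ → δ ∈ Δ × eval (restrict S v) δ ≡ one) →
         Any (λ δ → eval v δ ≡ one) (overPart S Δ)
  pick (δ , mδ , true) =
    lose (∈-filter⁺ (over? S) mδ over) (trans (sym (eval-restrict S v δ over)) true)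
    where
    over : Over S δ
    over = true-under-restrict⇒over S v δ true

mainTheorem20 : (Γ Δ : List Formula) → Γ ++ Δ ≢ [] → Valid Γ Δ →
    ¬ (varsL Δ ⊆ˢ varsL Γ) →
    Σ (List Formula) (λ Δ' → Δ' ⊂ˢ Δ × varsL Δ' ⊆ˢ varsL Γ × Valid Γ Δ')
mainTheorem20 Γ Δ _ valid ¬vars⊆ =
  overPart S Δ ,
  (overPart-⊆ S Δ , overPart-drops S Δ ¬vars⊆) ,
  overPart-vars S Δ ,
  valid-overPart S Γ Δ (λ m → m) valid
  where
  S : List Prop
  S = varsL Γ
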